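{- Let $J_8$ be the graph with vertices $v_1,\dots,v_8$ and edges $v_4v_3, v_3v_1, v_1v_2, v_2v_4$, $v_4v_5$, and $v_5v_8, v_8v_7, v_7v_6, v_6v_5$. Suppose each $v_i$ has a list $L(v_i)$ of colors with $|L(v_i)|=3$ for $i\in\{1,2,3,6,8\}$, $|L(v_4)|=|L(v_5)|=5$ and $|L(v_7)|=2$. Then $J_8^2$ has a proper coloring $f$ with $f(v_i)\in L(v_i)$ for all $i$.
   Context: The square $H^2$ of a graph $H$ has vertex set $V(H)$, two distinct vertices adjacent iff their distance in $H$ is at most $2$. -}

module Defs where

open import Data.Nat using (ℕ)
open import Data.Fin using (Fin; zero; suc)
open import Data.Fin.Patterns
open import Data.Product using (Σ; ∃; _×_; _,_)
open import Data.Sum using (_⊎_)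
open import Data.List using (List; length)
open import Data.List.Membership.Propositional using (_∈_)
open import Data.List.Relation.Unary.Unique.Propositional using (Unique)
open import Relation.Binary.PropositionalEquality using (_≡_)
open import Relation.Nullary using (¬_)

-- Vertices of J₈: vertex i : Fin 8 stands for v_(i+1), i.e. 0F = v₁, …, 7F = v₈.
V : Set
V = Fin 8

data Edge : V → V → Set where
  e43 : Edge 3F 2F
  e31 : Edge 2F 0F
  e12 : Edge 0F 1F
  e24 : Edge 1F 3F
  e45 : Edge 3F 4F
  e58 : Edge 4F 7F
  e87 : Edge 7F 6F
  e76 : Edge 6F 5F
  e65 : Edge 5F 4F

Adj : V → V → Set
Adj u v = Edge u v ⊎ Edge v u

Adj² : V → V → Set
Adj² u v = ¬ (u ≡ v) × (Adj u v ⊎ (∃ λ w → Adj u w × Adj w v))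

IsListOfSize : ℕ → List ℕ → Set
IsListOfSize k l = Unique l × length l ≡ k

size : V → ℕ
size 0F = 3
size 1F = 3
size 2F = 3
size 3F = 5
size 4F = 5
size 5F = 3
size 6F = 2
size 7F = 3

module Submission where

-- J₈² consists of two K₄'s, on v₁v₂v₃v₄ and on v₅v₆v₇v₈, joined by the edge v₄v₅, where moreover
-- v₄ sees v₆, v₈ and v₅ sees v₂, v₃. We first fix the colours x of v₄ and y of v₅. What is left
-- are two triangles, v₁v₂v₃ and v₇v₆v₈, whose apex (v₁, resp. v₇) sees only one of x, y while
-- both base vertices see x and y. How such a triangle with base palettes Q, R of size 3 can be
-- finished depends on whether R ⊆ Q: if not, the base can be coloured through any prescribed
-- colour of Q ∪ R other than x, y; if so, a colour outside Q is harmless and the base avoids any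
-- other single colour. A case analysis on this dichotomy for both triangles, and on how the apex
-- palettes meet the base palettes, then fixes x and y, each choice being a pigeonhole step: the
-- five colours of v₄ and of v₅ always leave room to avoid four prescribed ones. Finally, a
-- colouring is proper on J₈² as soon as it is injective on every closed neighbourhood of J₈.

open import Defs
open import Data.Fin.Patterns
open import Data.Product using (Σ; _×_; _,_; proj₁; proj₂)
open import Data.Sum using (inj₁; inj₂; swap)
open import Data.Empty using (⊥-elim)
open import Relation.Binary.PropositionalEquality using (refl; _≢_; ≢-sym)
open import Relation.Nullary.Decidable using (True; toWitness)

module Palettes where

  open import Data.Nat using (ℕ; suc; _+_; _≤_; _<_; _<?_; _≟_; z≤n; s≤s)
  open import Data.Nat.Properties using (1+n≰n; <⇒≱; n<1+n)
  open import Data.Product using (Σ-syntax; ∃-syntax)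
  open import Data.Sum using (_⊎_; [_,_]′)
  open import Relation.Nullary using (yes; no)
  open import Data.Vec.Base using (Vec; []; _∷_; fromList)
  open import Data.Vec.Membership.Propositional using (_∈_; find)
  open import Data.Vec.Membership.Propositional.Properties using (∈-fromList⁻)
  open import Data.Vec.Relation.Unary.Any using (here; there)
  open import Data.Vec.Relation.Unary.All as All using (All; []; _∷_)
  open import Data.Vec.Relation.Unary.All.Properties using (fromList⁺)
  open import Data.Vec.Relation.Unary.AllPairs using ([]; _∷_)
  open import Data.Vec.Relation.Unary.Unique.Propositional using (Unique)
  open import Data.List.Base using (List)
  open import Data.List.Membership.Propositional using () renaming (_∈_ to _∈ₗ_)
  open import Data.List.Relation.Unary.AllPairs using ([]; _∷_)
  open import Data.List.Relation.Unary.Unique.Propositional using () renaming (Unique to Uniqueₗ)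

  private
    variable
      m n : ℕ
      a c d k s t w : ℕ

  infix 4 _#_ _⊆_ _⊈_

  _#_ : ℕ → Vec ℕ n → Set
  c # xs = All (c ≢_) xs

  _⊆_ : Vec ℕ m → Vec ℕ n → Set
  xs ⊆ ys = ∀ {c} → c ∈ xs → c ∈ ys

  _⊈_ : Vec ℕ m → Vec ℕ n → Set
  xs ⊈ ys = ∃[ c ] c ∈ xs × c # ys

  ∈-#⇒≢ : {xs : Vec ℕ n} → c ∈ xs → d # xs → c ≢ d
  ∈-#⇒≢ c∈xs d#xs = ≢-sym (All.lookup d#xs c∈xs)

  #-anti-mono : {xs : Vec ℕ m} {ys : Vec ℕ n} → xs ⊆ ys → c # ys → c # xs
  #-anti-mono {xs = []}    _     _    = []
  #-anti-mono {xs = _ ∷ _} xs⊆ys c#ys =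
    All.lookup c#ys (xs⊆ys (here refl)) ∷ #-anti-mono (λ d∈xs → xs⊆ys (there d∈xs)) c#ys

  ∈-∷⇒∈⊎ : {xs : Vec ℕ m} {ys : Vec ℕ n} → c ∈ d ∷ xs → d ∈ ys → c ∈ xs ⊎ c ∈ ys
  ∈-∷⇒∈⊎ (here refl)  d∈ys = inj₂ d∈ys
  ∈-∷⇒∈⊎ (there c∈xs) _    = inj₁ c∈xs

  ∈-or-# : ∀ c (xs : Vec ℕ n) → c ∈ xs ⊎ c # xs
  ∈-or-# c [] = inj₂ []
  ∈-or-# c (x ∷ xs) with c ≟ x | ∈-or-# c xs
  ... | yes c≡x | _         = inj₁ (here c≡x)
  ... | no _    | inj₁ c∈xs = inj₁ (there c∈xs)
  ... | no c≢x  | inj₂ c#xs = inj₂ (c≢x ∷ c#xs)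

  ⊈-or-⊆ : (xs : Vec ℕ m) (ys : Vec ℕ n) → xs ⊈ ys ⊎ xs ⊆ ys
  ⊈-or-⊆ xs ys with All.decide (λ c → ∈-or-# c ys) xs
  ... | inj₁ xs⊆ys = inj₂ (All.lookup xs⊆ys)
  ... | inj₂ xs⊈ys = inj₁ (find xs⊈ys)

  remove : (xs : Vec ℕ (suc n)) → c ∈ xs → Vec ℕ n
  remove (_ ∷ xs)     (here _)   = xs
  remove (x ∷ y ∷ xs) (there c∈) = x ∷ remove (y ∷ xs) c∈

  ∈-remove : {xs : Vec ℕ (suc n)} (c∈xs : c ∈ xs) → d ∈ xs → d ≢ c → d ∈ remove xs c∈xs
  ∈-remove (here refl) (here refl) d≢c = ⊥-elim (d≢c refl)
  ∈-remove (here refl) (there d∈)  _   = d∈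
  ∈-remove {xs = _ ∷ _ ∷ _} (there _)  (here refl) _   = here refl
  ∈-remove {xs = _ ∷ _ ∷ _} (there c∈) (there d∈)  d≢c = there (∈-remove c∈ d∈ d≢c)

  pigeonhole : {xs : Vec ℕ m} {ys : Vec ℕ n} → Unique xs → xs ⊆ ys → m ≤ n
  pigeonhole {xs = []} _ _ = z≤n
  pigeonhole {xs = x ∷ xs} {ys = []} _ xs⊆ys with xs⊆ys (here refl)
  ... | ()
  pigeonhole {xs = x ∷ xs} {ys = _ ∷ _} (x#xs ∷ xs!) xs⊆ys = s≤s (pigeonhole xs! λ c∈xs →
    ∈-remove (xs⊆ys (here refl)) (xs⊆ys (there c∈xs)) (∈-#⇒≢ c∈xs x#xs))

  ⊈-if-larger : {xs : Vec ℕ n} → Unique xs → (ys : Vec ℕ m) → m < n → xs ⊈ ys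
  ⊈-if-larger xs! ys m<n with ⊈-or-⊆ _ ys
  ... | inj₁ xs⊈ys = xs⊈ys
  ... | inj₂ xs⊆ys = ⊥-elim (<⇒≱ m<n (pigeonhole xs! xs⊆ys))

  outside : {xs : Vec ℕ n} → Unique xs → (ys : Vec ℕ m) → {True (m <? n)} → xs ⊈ ys
  outside xs! ys {m<n} = ⊈-if-larger xs! ys (toWitness m<n)

  ⊆-reverse : {xs ys : Vec ℕ n} → Unique xs → xs ⊆ ys → ys ⊆ xs
  ⊆-reverse {ys = []} _ _ ()
  ⊆-reverse {xs = xs} {ys = _ ∷ _} xs! xs⊆ys {c} c∈ys with ∈-or-# c xs
  ... | inj₁ c∈xs = c∈xs
  ... | inj₂ c#xs =
    ⊥-elim (1+n≰n (pigeonhole xs! λ d∈xs → ∈-remove c∈ys (xs⊆ys d∈xs) (∈-#⇒≢ d∈xs c#xs)))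

  ∃-missing : {xs : Vec ℕ (suc n)} {ys : Vec ℕ n} →
              Unique xs → Unique ys → ys ⊆ xs → ∃[ w ] xs ⊆ w ∷ ys
  ∃-missing {n = n} {ys = ys} xs! ys! ys⊆xs
    with w , w∈xs , w#ys ← ⊈-if-larger xs! ys (n<1+n n)
    = w , ⊆-reverse (w#ys ∷ ys!) λ { (here refl) → w∈xs ; (there c∈ys) → ys⊆xs c∈ys }

  record BaseColouring (Q R : Vec ℕ 3) (s t : ℕ) : Set where
    constructor base
    field
      q r : ℕ
      q∈Q : q ∈ Q
      r∈R : r ∈ R
      q≢r : q ≢ r
      q≢s : q ≢ s
      q≢t : q ≢ t
      r≢s : r ≢ s
      r≢t : r ≢ t

  record TriangleColouring (P : Vec ℕ m) (Q R : Vec ℕ 3) (s t : ℕ) : Set where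
    constructor triangle
    field
      edge : BaseColouring Q R s t
    open BaseColouring edge public
    field
      p : ℕ
      p∈P : p ∈ P
      p≢s : p ≢ s
      p≢q : p ≢ q
      p≢r : p ≢ r

  swap-avoided : {Q R : Vec ℕ 3} → BaseColouring Q R t s → BaseColouring Q R s t
  swap-avoided (base q r q∈Q r∈R q≢r q≢t q≢s r≢t r≢s) = base q r q∈Q r∈R q≢r q≢s q≢t r≢s r≢t

  record BaseThrough (Q R : Vec ℕ 3) (s t k : ℕ) : Set where
    field
      colouring : BaseColouring Q R s t
      other : ℕ
    open BaseColouring colouring public
    field
      avoids : c ≢ k → c ≢ other → c ≢ q × c ≢ r

  through-Q : {Q R : Vec ℕ 3} → k ∈ Q → k ≢ s → k ≢ t →
              c ∈ R → c ≢ s → c ≢ t → c ≢ k → BaseThrough Q R s t k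
  through-Q {c = c} k∈Q k≢s k≢t c∈R c≢s c≢t c≢k = record
    { colouring = base _ c k∈Q c∈R (≢-sym c≢k) k≢s k≢t c≢s c≢t
    ; other     = c
    ; avoids    = _,_
    }

  through-R : {Q R : Vec ℕ 3} → k ∈ R → k ≢ s → k ≢ t →
              c ∈ Q → c ≢ s → c ≢ t → c ≢ k → BaseThrough Q R s t k
  through-R {c = c} k∈R k≢s k≢t c∈Q c≢s c≢t c≢k = record
    { colouring = base c _ c∈Q k∈R c≢k c≢s c≢t k≢s k≢t
    ; other     = c
    ; avoids    = λ d≢k d≢c → d≢c , d≢k
    }

  crown : {P : Vec ℕ m} {Q R : Vec ℕ 3} (b : BaseThrough Q R s t k) →
          c ∈ P → c ≢ s → c ≢ k → c ≢ BaseThrough.other b → TriangleColouring P Q R s t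
  crown b c∈P c≢s c≢k c≢o =
    triangle colouring _ c∈P c≢s (proj₁ (avoids c≢k c≢o)) (proj₂ (avoids c≢k c≢o))
    where open BaseThrough b

  module _ {Q R : Vec ℕ 3} (Q! : Unique Q) (R! : Unique R) where

    base-through : R ⊈ Q → k ∈ Q ⊎ k ∈ R → k ≢ s → k ≢ t → BaseThrough Q R s t k
    base-through {k = k} {s = s} {t = t} (u , u∈R , u#Q) k∈Q⊎R k≢s k≢t
      with ⊈-or-⊆ Q (s ∷ t ∷ k ∷ []) | ⊈-or-⊆ R (s ∷ t ∷ k ∷ [])
    ... | inj₁ (q , q∈Q , q≢s ∷ q≢t ∷ q≢k ∷ []) | inj₁ (r , r∈R , r≢s ∷ r≢t ∷ r≢k ∷ []) =
          [ (λ k∈Q → through-Q k∈Q k≢s k≢t r∈R r≢s r≢t r≢k)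
          , (λ k∈R → through-R k∈R k≢s k≢t q∈Q q≢s q≢t q≢k) ]′ k∈Q⊎R
    ... | inj₁ (q , q∈Q , q≢s ∷ q≢t ∷ q≢k ∷ []) | inj₂ R⊆stk =
          through-R (⊆-reverse R! R⊆stk (there (there (here refl)))) k≢s k≢t q∈Q q≢s q≢t q≢k
    ... | inj₂ Q⊆stk | inj₁ (r , r∈R , r≢s ∷ r≢t ∷ r≢k ∷ []) =
          through-Q (⊆-reverse Q! Q⊆stk (there (there (here refl)))) k≢s k≢t r∈R r≢s r≢t r≢k
    -- A palette of size 3 inside {s, t, k} is all of it, so both inclusions would give R ⊆ Q.
    ... | inj₂ Q⊆stk | inj₂ R⊆stk = ⊥-elim (All.lookup u#Q (⊆-reverse Q! Q⊆stk (R⊆stk u∈R)) refl)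

    triangle-s#P : R ⊈ Q → {P : Vec ℕ (3 + m)} → Unique P → s # P → TriangleColouring P Q R s t
    triangle-s#P {s = s} {t = t} R⊈Q P! s#P
      with k , k∈Q , k≢s ∷ k≢t ∷ [] ← outside Q! (s ∷ t ∷ [])
      with b ← base-through R⊈Q (inj₁ k∈Q) k≢s k≢t
      with c , c∈P , c≢k ∷ c≢o ∷ [] ← outside P! (k ∷ BaseThrough.other b ∷ [])
      = crown b c∈P (∈-#⇒≢ c∈P s#P) c≢k c≢o

    triangle-through : R ⊈ Q → {P : Vec ℕ (3 + m)} → Unique P →
                       k ∈ Q ⊎ k ∈ R → k # P → t ≢ k → TriangleColouring P Q R s t
    triangle-through {s = s} R⊈Q {P} P! k∈Q⊎R k#P t≢k with ∈-or-# s P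
    ... | inj₂ s#P = triangle-s#P R⊈Q P! s#P
    ... | inj₁ s∈P
      with b ← base-through R⊈Q k∈Q⊎R (All.lookup k#P s∈P) (≢-sym t≢k)
      with c , c∈P , c≢s ∷ c≢o ∷ [] ← outside P! (s ∷ BaseThrough.other b ∷ [])
      = crown b c∈P c≢s (∈-#⇒≢ c∈P k#P) c≢o

    triangle-through-s#P : R ⊈ Q → {P : Vec ℕ (2 + m)} → Unique P →
                           k ∈ Q ⊎ k ∈ R → k # P → k ≢ s → k ≢ t → s # P →
                           TriangleColouring P Q R s t
    triangle-through-s#P R⊈Q P! k∈Q⊎R k#P k≢s k≢t s#P
      with b ← base-through R⊈Q k∈Q⊎R k≢s k≢t
      with c , c∈P , c≢o ∷ [] ← outside P! (BaseThrough.other b ∷ [])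
      = crown b c∈P (∈-#⇒≢ c∈P s#P) (∈-#⇒≢ c∈P k#P) c≢o

    twin-base : R ⊆ Q → s # Q → BaseColouring Q R s t
    twin-base {t = t} R⊆Q s#Q
      with q , q∈Q , q≢t ∷ [] ← outside Q! (t ∷ [])
      with r , r∈R , r≢t ∷ r≢q ∷ [] ← outside R! (t ∷ q ∷ [])
      = base q r q∈Q r∈R (≢-sym r≢q) (∈-#⇒≢ q∈Q s#Q) q≢t (∈-#⇒≢ (R⊆Q r∈R) s#Q) r≢t

    twin-triangle-s#P : R ⊆ Q → s # Q → {P : Vec ℕ (3 + m)} → Unique P → s # P →
                        TriangleColouring P Q R s t
    twin-triangle-s#P R⊆Q s#Q P! s#P
      with b@(base q r _ _ _ _ _ _ _) ← twin-base R⊆Q s#Q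
      with c , c∈P , c≢q ∷ c≢r ∷ [] ← outside P! (q ∷ r ∷ [])
      = triangle b c c∈P (∈-#⇒≢ c∈P s#P) c≢q c≢r

    twin-triangle-apex#Q : R ⊆ Q → s # Q → {P : Vec ℕ m} → c ∈ P → c # Q → c ≢ s →
                           TriangleColouring P Q R s t
    twin-triangle-apex#Q R⊆Q s#Q c∈P c#Q c≢s
      with b@(base _ _ q∈Q r∈R _ _ _ _ _) ← twin-base R⊆Q s#Q
      = triangle b _ c∈P c≢s (All.lookup c#Q q∈Q) (All.lookup c#Q (R⊆Q r∈R))

    twin-triangle-t∈P : R ⊆ Q → s # Q → {P : Vec ℕ m} → t ∈ P → s ≢ t → TriangleColouring P Q R s t
    twin-triangle-t∈P R⊆Q s#Q t∈P s≢t
      with b@(base _ _ _ _ _ _ q≢t _ r≢t) ← twin-base R⊆Q s#Q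
      = triangle b _ t∈P (≢-sym s≢t) (≢-sym q≢t) (≢-sym r≢t)

    twin-triangle-s,t#Q : R ⊆ Q → s # Q → t # Q → {P : Vec ℕ m} → c ∈ P → c ≢ s →
                          TriangleColouring P Q R s t
    twin-triangle-s,t#Q {c = c} R⊆Q s#Q t#Q c∈P c≢s
      with q , q∈Q , q≢c ∷ [] ← outside Q! (c ∷ [])
      with r , r∈R , r≢c ∷ r≢q ∷ [] ← outside R! (c ∷ q ∷ [])
      = triangle (base q r q∈Q r∈R (≢-sym r≢q) (∈-#⇒≢ q∈Q s#Q) (∈-#⇒≢ q∈Q t#Q)
                       (∈-#⇒≢ (R⊆Q r∈R) s#Q) (∈-#⇒≢ (R⊆Q r∈R) t#Q))
                 c c∈P c≢s (≢-sym q≢c) (≢-sym r≢c)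

    twin-triangle-t#Q : R ⊆ Q → t # Q → {P : Vec ℕ (2 + m)} → Unique P → c ∈ P → c # Q →
                        TriangleColouring P Q R s t
    twin-triangle-t#Q {s = s} R⊆Q t#Q P! c∈P c#Q with ∈-or-# s Q
    ... | inj₁ s∈Q
      with b@(base _ _ q∈Q r∈R _ _ _ _ _) ← swap-avoided (twin-base R⊆Q t#Q)
      = triangle b _ c∈P (All.lookup c#Q s∈Q) (All.lookup c#Q q∈Q) (All.lookup c#Q (R⊆Q r∈R))
    ... | inj₂ s#Q
      with d , d∈P , d≢s ∷ [] ← outside P! (s ∷ [])
      = twin-triangle-s,t#Q R⊆Q s#Q t#Q d∈P d≢s

    twin-triangle-P⊆Q : R ⊆ Q → {P : Vec ℕ (suc m)} → Unique P → P ⊆ Q → Q ⊆ w ∷ P →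
                        s # Q → t ≢ w → s ≢ t → TriangleColouring P Q R s t
    twin-triangle-P⊆Q {t = t} R⊆Q P! P⊆Q Q⊆wP s#Q t≢w s≢t with ∈-or-# t Q
    ... | inj₁ t∈Q = twin-triangle-t∈P R⊆Q s#Q t∈P s≢t
      where
      t∈P : t ∈ _
      t∈P with Q⊆wP t∈Q
      ... | here t≡w  = ⊥-elim (t≢w t≡w)
      ... | there t∈P = t∈P
    ... | inj₂ t#Q
      with c , c∈P , [] ← outside P! []
      = twin-triangle-s,t#Q R⊆Q s#Q t#Q c∈P (∈-#⇒≢ (P⊆Q c∈P) s#Q)

  -- A, B, C, X, Y, D, G, E are the palettes of v₁, …, v₈; x and y colour v₄ and v₅, the
  -- triangles are v₁v₂v₃ with apex v₁ and v₇v₆v₈ with apex v₇.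
  record J₈²Colouring (A B C : Vec ℕ 3) (X Y : Vec ℕ 5) (D : Vec ℕ 3) (G : Vec ℕ 2) (E : Vec ℕ 3) :
                      Set where
    constructor colouring
    field
      x y : ℕ
      x∈X : x ∈ X
      y∈Y : y ∈ Y
      x≢y : x ≢ y
      left : TriangleColouring A B C x y
      right : TriangleColouring G D E y x

  module _ {A B C D E : Vec ℕ 3} {X Y : Vec ℕ 5} {G : Vec ℕ 2}
           (A! : Unique A) (B! : Unique B) (C! : Unique C) (X! : Unique X)
           (Y! : Unique Y) (D! : Unique D) (G! : Unique G) (E! : Unique E) where

    left-for-every-y : ∃[ x ] x ∈ X × (∀ y → TriangleColouring A B C x y)
    left-for-every-y with ⊈-or-⊆ C B
    ... | inj₁ C⊈B
      with x , x∈X , x#A ← outside X! A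
      = x , x∈X , λ _ → triangle-s#P B! C! C⊈B A! x#A
    ... | inj₂ C⊆B
      with x₁ , x₁∈X , x₁#B ← outside X! B
      with ⊈-or-⊆ A (x₁ ∷ B)
    ... | inj₁ (a , a∈A , a≢x₁ ∷ a#B) =
          x₁ , x₁∈X , λ _ → twin-triangle-apex#Q B! C! C⊆B x₁#B a∈A a#B a≢x₁
    ... | inj₂ A⊆x₁B
      with x₂ , x₂∈X , x₂#x₁B@(_ ∷ x₂#B) ← outside X! (x₁ ∷ B)
      = x₂ , x₂∈X , λ _ → twin-triangle-s#P B! C! C⊆B x₂#B A! (#-anti-mono A⊆x₁B x₂#x₁B)

    colouring-E⊈D : E ⊈ D → J₈²Colouring A B C X Y D G E
    colouring-E⊈D E⊈D@(v , v∈E , v#D)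
      with x , x∈X , left ← left-for-every-y
      with k , k∈vD , k≢x ∷ k#G ← outside (v#D ∷ D!) (x ∷ G)
      with y , y∈Y , y≢x ∷ y≢k ∷ y#G ← outside Y! (x ∷ k ∷ G)
      = colouring x y x∈X y∈Y (≢-sym y≢x) (left y)
          (triangle-through-s#P D! E! E⊈D G! (∈-∷⇒∈⊎ k∈vD v∈E) k#G (≢-sym y≢k) k≢x y#G)

    module _ {w} (E⊆D : E ⊆ D) (G⊆D : G ⊆ D) (D⊆wG : D ⊆ w ∷ G) where

      colouring-G⊆D : ∀ {x y} → x ∈ X → y ∈ Y → y # D → x ≢ w → x ≢ y →
                      TriangleColouring A B C x y → J₈²Colouring A B C X Y D G E
      colouring-G⊆D x∈X y∈Y y#D x≢w x≢y left =
        colouring _ _ x∈X y∈Y x≢y left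
          (twin-triangle-P⊆Q D! E! E⊆D G! G⊆D D⊆wG y#D x≢w (≢-sym x≢y))

      colouring-y#B : C ⊆ B → a ∈ A → a # B → ∀ {y} → y ∈ Y → y # D → y # B →
                      J₈²Colouring A B C X Y D G E
      colouring-y#B C⊆B a∈A a#B {y} y∈Y y#D y#B
        with x , x∈X , x≢w ∷ x≢y ∷ [] ← outside X! (w ∷ y ∷ [])
        = colouring-G⊆D x∈X y∈Y y#D x≢w x≢y (twin-triangle-t#Q B! C! C⊆B y#B A! a∈A a#B)

      -- Here B = {y₁, y₂, r}, so a colour a ∈ A ∖ {x, r} either lies outside B or is one of the
      -- yᵢ; in the latter case v₁ and v₅ can both be coloured a.
      colouring-y₁,y₂∈B : C ⊆ B → ∀ {y₁ y₂} → y₁ ∈ Y → y₂ ∈ Y → y₁ # D → y₂ # D → y₂ ≢ y₁ →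
                          y₁ ∈ B → y₂ ∈ B → J₈²Colouring A B C X Y D G E
      colouring-y₁,y₂∈B C⊆B {y₁} {y₂} y₁∈Y y₂∈Y y₁#D y₂#D y₂≢y₁ y₁∈B y₂∈B
        with x , x∈X , x≢w ∷ x#B ← outside X! (w ∷ B)
        with x≢y₁ ← All.lookup x#B y₁∈B
        with x≢y₂ ← All.lookup x#B y₂∈B
        with r , r∈B , r≢y₁ ∷ r≢y₂ ∷ [] ← outside B! (y₁ ∷ y₂ ∷ [])
        with a , a∈A , a≢x ∷ a≢r ∷ [] ← outside A! (x ∷ r ∷ [])
        with ∈-or-# a B
      ... | inj₂ a#B =
            colouring-G⊆D x∈X y₁∈Y y₁#D x≢w x≢y₁ (twin-triangle-apex#Q B! C! C⊆B x#B a∈A a#B a≢x)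
      ... | inj₁ a∈B with ⊆-reverse y₁y₂r! y₁y₂r⊆B a∈B
        where
        y₁y₂r! : Unique (y₁ ∷ y₂ ∷ r ∷ [])
        y₁y₂r! = (≢-sym y₂≢y₁ ∷ ≢-sym r≢y₁ ∷ []) ∷ (≢-sym r≢y₂ ∷ []) ∷ [] ∷ []
        y₁y₂r⊆B : (y₁ ∷ y₂ ∷ r ∷ []) ⊆ B
        y₁y₂r⊆B (here refl)                 = y₁∈B
        y₁y₂r⊆B (there (here refl))         = y₂∈B
        y₁y₂r⊆B (there (there (here refl))) = r∈B
      ... | here refl =
            colouring-G⊆D x∈X y₁∈Y y₁#D x≢w x≢y₁ (twin-triangle-t∈P B! C! C⊆B x#B a∈A x≢y₁)
      ... | there (here refl) =
            colouring-G⊆D x∈X y₂∈Y y₂#D x≢w x≢y₂ (twin-triangle-t∈P B! C! C⊆B x#B a∈A x≢y₂)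
      ... | there (there (here a≡r)) = ⊥-elim (a≢r a≡r)

      colouring-a#B : C ⊆ B → a ∈ A → a # B → J₈²Colouring A B C X Y D G E
      colouring-a#B C⊆B a∈A a#B
        with y₁ , y₁∈Y , y₁#D ← outside Y! D
        with y₂ , y₂∈Y , y₂≢y₁ ∷ y₂#D ← outside Y! (y₁ ∷ D)
        with ∈-or-# y₁ B | ∈-or-# y₂ B
      ... | inj₂ y₁#B | _         = colouring-y#B C⊆B a∈A a#B y₁∈Y y₁#D y₁#B
      ... | _         | inj₂ y₂#B = colouring-y#B C⊆B a∈A a#B y₂∈Y y₂#D y₂#B
      ... | inj₁ y₁∈B | inj₁ y₂∈B = colouring-y₁,y₂∈B C⊆B y₁∈Y y₂∈Y y₁#D y₂#D y₂≢y₁ y₁∈B y₂∈B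

    colouring-C⊈B : C ⊈ B → E ⊆ D → J₈²Colouring A B C X Y D G E
    colouring-C⊈B C⊈B@(u , u∈C , u#B) E⊆D
      with k , k∈uB , k#A ← outside (u#B ∷ B!) A
      with ⊈-or-⊆ G D
    ... | inj₁ (β , β∈G , β#D)
      with x , x∈X , x#D ← outside X! D
      with y , y∈Y , y≢x ∷ y≢k ∷ [] ← outside Y! (x ∷ k ∷ [])
      = colouring x y x∈X y∈Y (≢-sym y≢x)
          (triangle-through B! C! C⊈B A! (∈-∷⇒∈⊎ k∈uB u∈C) k#A y≢k)
          (twin-triangle-t#Q D! E! E⊆D x#D G! β∈G β#D)
    ... | inj₂ G⊆D
      with w , D⊆wG ← ∃-missing D! G! G⊆D
      with y , y∈Y , y≢k ∷ y#D ← outside Y! (k ∷ D)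
      with x , x∈X , x≢w ∷ x≢y ∷ [] ← outside X! (w ∷ y ∷ [])
      = colouring-G⊆D E⊆D G⊆D D⊆wG x∈X y∈Y y#D x≢w x≢y
          (triangle-through B! C! C⊈B A! (∈-∷⇒∈⊎ k∈uB u∈C) k#A y≢k)

    colouring-A⊆B-G⊈D : C ⊆ B → E ⊆ D → A ⊆ B → G ⊈ D → J₈²Colouring A B C X Y D G E
    colouring-A⊆B-G⊈D C⊆B E⊆D A⊆B (β , β∈G , β#D)
      with x , x∈X , x#B ← outside X! B
      with ∈-or-# x D
    ... | inj₂ x#D
      with y , y∈Y , y≢x ∷ [] ← outside Y! (x ∷ [])
      = colouring x y x∈X y∈Y (≢-sym y≢x)
          (twin-triangle-s#P B! C! C⊆B x#B A! (#-anti-mono A⊆B x#B))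
          (twin-triangle-t#Q D! E! E⊆D x#D G! β∈G β#D)
    ... | inj₁ x∈D
      with y , y∈Y , y≢β ∷ y#D ← outside Y! (β ∷ D)
      = colouring x y x∈X y∈Y (∈-#⇒≢ x∈D y#D)
          (twin-triangle-s#P B! C! C⊆B x#B A! (#-anti-mono A⊆B x#B))
          (twin-triangle-apex#Q D! E! E⊆D y#D β∈G β#D (≢-sym y≢β))

    colouring-C⊆B : C ⊆ B → E ⊆ D → J₈²Colouring A B C X Y D G E
    colouring-C⊆B C⊆B E⊆D with ⊈-or-⊆ A B | ⊈-or-⊆ G D
    ... | inj₁ (a , a∈A , a#B) | inj₁ (β , β∈G , β#D)
      with x , x∈X , x#D ← outside X! D
      with y , y∈Y , y≢x ∷ y#B ← outside Y! (x ∷ B)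
      = colouring x y x∈X y∈Y (≢-sym y≢x)
          (twin-triangle-t#Q B! C! C⊆B y#B A! a∈A a#B)
          (twin-triangle-t#Q D! E! E⊆D x#D G! β∈G β#D)
    ... | inj₂ A⊆B | inj₁ G⊈D = colouring-A⊆B-G⊈D C⊆B E⊆D A⊆B G⊈D
    ... | inj₁ (a , a∈A , a#B) | inj₂ G⊆D
      with w , D⊆wG ← ∃-missing D! G! G⊆D
      = colouring-a#B E⊆D G⊆D D⊆wG C⊆B a∈A a#B
    ... | inj₂ A⊆B | inj₂ G⊆D
      with w , D⊆wG ← ∃-missing D! G! G⊆D
      with x , x∈X , x≢w ∷ x#B ← outside X! (w ∷ B)
      with y , y∈Y , y≢x ∷ y#D ← outside Y! (x ∷ D)
      = colouring-G⊆D E⊆D G⊆D D⊆wG x∈X y∈Y y#D x≢w (≢-sym y≢x)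
          (twin-triangle-s#P B! C! C⊆B x#B A! (#-anti-mono A⊆B x#B))

    J₈²-colouring : J₈²Colouring A B C X Y D G E
    J₈²-colouring with ⊈-or-⊆ E D | ⊈-or-⊆ C B
    ... | inj₁ E⊈D | _        = colouring-E⊈D E⊈D
    ... | inj₂ E⊆D | inj₁ C⊈B = colouring-C⊈B C⊈B E⊆D
    ... | inj₂ E⊆D | inj₂ C⊆B = colouring-C⊆B C⊆B E⊆D

  Unique-fromList : {l : List ℕ} → Uniqueₗ l → Unique (fromList l)
  Unique-fromList []         = []
  Unique-fromList (c#l ∷ l!) = fromList⁺ c#l ∷ Unique-fromList l!

  palette : {l : List ℕ} → IsListOfSize n l → Σ[ P ∈ Vec ℕ n ] Unique P × (∀ {c} → c ∈ P → c ∈ₗ l)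
  palette {l = l} (l! , refl) = fromList l , Unique-fromList l! , ∈-fromList⁻

  module _ {L : V → List ℕ} (L-size : ∀ v → IsListOfSize (size v) (L v)) where

    palettes : (v : V) → Vec ℕ (size v)
    palettes v = proj₁ (palette (L-size v))

    ∈-palettes⁻ : ∀ v {c} → c ∈ palettes v → c ∈ₗ L v
    ∈-palettes⁻ v = proj₂ (proj₂ (palette (L-size v)))

    J₈²-colouring-of-lists : J₈²Colouring (palettes 0F) (palettes 1F) (palettes 2F) (palettes 3F)
                                          (palettes 4F) (palettes 5F) (palettes 6F) (palettes 7F)
    J₈²-colouring-of-lists =
      J₈²-colouring (p! 0F) (p! 1F) (p! 2F) (p! 3F) (p! 4F) (p! 5F) (p! 6F) (p! 7F)
      where
      p! : ∀ v → Unique (palettes v)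
      p! v = proj₁ (proj₂ (palette (L-size v)))

open Palettes using (TriangleColouring; J₈²Colouring; J₈²-colouring-of-lists; ∈-palettes⁻)

open import Data.Nat using (ℕ)
open import Data.Fin.Properties using () renaming (_≟_ to _≟ᶠ_)
open import Data.List using (List; []; _∷_; map)
open import Data.List.Membership.Propositional using (_∈_)
open import Data.List.Membership.Propositional.Properties using (∈-map⁺)
open import Data.List.Membership.DecPropositional (_≟ᶠ_ {8}) using (_∈?_)
open import Data.List.Relation.Unary.Any using (here; there)
open import Data.List.Relation.Unary.All as All using ([]; _∷_)
open import Data.List.Relation.Unary.AllPairs using ([]; _∷_)
open import Data.List.Relation.Unary.Unique.Propositional using (Unique)

module _ {m P Q R s t} (T : TriangleColouring {m} P Q R s t) where
  open TriangleColouring T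

  pqr-distinct : Unique (p ∷ q ∷ r ∷ [])
  pqr-distinct = (p≢q ∷ p≢r ∷ []) ∷ (q≢r ∷ []) ∷ [] ∷ []

  pqs-distinct : Unique (p ∷ q ∷ s ∷ [])
  pqs-distinct = (p≢q ∷ p≢s ∷ []) ∷ (q≢s ∷ []) ∷ [] ∷ []

  prs-distinct : Unique (p ∷ r ∷ s ∷ [])
  prs-distinct = (p≢r ∷ p≢s ∷ []) ∷ (r≢s ∷ []) ∷ [] ∷ []

  qrst-distinct : s ≢ t → Unique (q ∷ r ∷ s ∷ t ∷ [])
  qrst-distinct s≢t = (q≢r ∷ q≢s ∷ q≢t ∷ []) ∷ (r≢s ∷ r≢t ∷ []) ∷ (s≢t ∷ []) ∷ [] ∷ []

-- Each list is ordered so that its image under the colouring below is one of the lists above.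
closedNbhd : V → List V
closedNbhd 0F = 0F ∷ 1F ∷ 2F ∷ []
closedNbhd 1F = 0F ∷ 1F ∷ 3F ∷ []
closedNbhd 2F = 0F ∷ 2F ∷ 3F ∷ []
closedNbhd 3F = 1F ∷ 2F ∷ 3F ∷ 4F ∷ []
closedNbhd 4F = 5F ∷ 7F ∷ 4F ∷ 3F ∷ []
closedNbhd 5F = 6F ∷ 5F ∷ 4F ∷ []
closedNbhd 6F = 6F ∷ 5F ∷ 7F ∷ []
closedNbhd 7F = 6F ∷ 7F ∷ 4F ∷ []

member : ∀ {u : V} {us} {u∈us : True (u ∈? us)} → u ∈ us
member {u∈us = u∈us} = toWitness u∈us

∈-closedNbhd : ∀ {u w} → Edge u w → u ∈ closedNbhd w × w ∈ closedNbhd u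
∈-closedNbhd e43 = member , member
∈-closedNbhd e31 = member , member
∈-closedNbhd e12 = member , member
∈-closedNbhd e24 = member , member
∈-closedNbhd e45 = member , member
∈-closedNbhd e58 = member , member
∈-closedNbhd e87 = member , member
∈-closedNbhd e76 = member , member
∈-closedNbhd e65 = member , member

adj-∈-closedNbhd : ∀ {u w} → Adj u w → u ∈ closedNbhd w
adj-∈-closedNbhd (inj₁ u→w) = proj₁ (∈-closedNbhd u→w)
adj-∈-closedNbhd (inj₂ w→u) = proj₂ (∈-closedNbhd w→u)

∈-closedNbhd-self : ∀ w → w ∈ closedNbhd w
∈-closedNbhd-self 0F = member
∈-closedNbhd-self 1F = member
∈-closedNbhd-self 2F = member
∈-closedNbhd-self 3F = member
∈-closedNbhd-self 4F = member
∈-closedNbhd-self 5F = member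
∈-closedNbhd-self 6F = member
∈-closedNbhd-self 7F = member

distinct-on : ∀ {X : Set} (f : X → ℕ) {xs u v} →
              u ∈ xs → v ∈ xs → Unique (map f xs) → u ≢ v → f u ≢ f v
distinct-on f (here refl)  (here refl)  _          u≢v = ⊥-elim (u≢v refl)
distinct-on f (here refl)  (there v∈xs) (fu# ∷ _)  _   = All.lookup fu# (∈-map⁺ f v∈xs)
distinct-on f (there u∈xs) (here refl)  (fv# ∷ _)  _   = ≢-sym (All.lookup fv# (∈-map⁺ f u∈xs))
distinct-on f (there u∈xs) (there v∈xs) (_ ∷ fxs!) u≢v = distinct-on f u∈xs v∈xs fxs! u≢v

square-proper : (f : V → ℕ) → (∀ w → Unique (map f (closedNbhd w))) → ∀ u v → Adj² u v → f u ≢ f v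
square-proper f f! u v (u≢v , inj₁ u~v) =
  distinct-on f (adj-∈-closedNbhd u~v) (∈-closedNbhd-self v) (f! v) u≢v
square-proper f f! u v (u≢v , inj₂ (w , u~w , w~v)) =
  distinct-on f (adj-∈-closedNbhd u~w) (adj-∈-closedNbhd (swap w~v)) (f! w) u≢v

module _ (L : V → List ℕ) (L-size : ∀ v → IsListOfSize (size v) (L v)) where
  open J₈²Colouring (J₈²-colouring-of-lists L-size)
  private
    module Left  = TriangleColouring left
    module Right = TriangleColouring right

  colour : V → ℕ
  colour 0F = Left.p
  colour 1F = Left.q
  colour 2F = Left.r
  colour 3F = x
  colour 4F = y
  colour 5F = Right.q
  colour 6F = Right.p
  colour 7F = Right.r

  colour∈L : ∀ v → colour v ∈ L v
  colour∈L 0F = ∈-palettes⁻ L-size 0F Left.p∈P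
  colour∈L 1F = ∈-palettes⁻ L-size 1F Left.q∈Q
  colour∈L 2F = ∈-palettes⁻ L-size 2F Left.r∈R
  colour∈L 3F = ∈-palettes⁻ L-size 3F x∈X
  colour∈L 4F = ∈-palettes⁻ L-size 4F y∈Y
  colour∈L 5F = ∈-palettes⁻ L-size 5F Right.q∈Q
  colour∈L 6F = ∈-palettes⁻ L-size 6F Right.p∈P
  colour∈L 7F = ∈-palettes⁻ L-size 7F Right.r∈R

  colour-injective-on-closedNbhd : ∀ w → Unique (map colour (closedNbhd w))
  colour-injective-on-closedNbhd 0F = pqr-distinct left
  colour-injective-on-closedNbhd 1F = pqs-distinct left
  colour-injective-on-closedNbhd 2F = prs-distinct left
  colour-injective-on-closedNbhd 3F = qrst-distinct left x≢y
  colour-injective-on-closedNbhd 4F = qrst-distinct right (≢-sym x≢y)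
  colour-injective-on-closedNbhd 5F = pqs-distinct right
  colour-injective-on-closedNbhd 6F = pqr-distinct right
  colour-injective-on-closedNbhd 7F = prs-distinct right

lemma5p19 : (L : V → List ℕ) → (∀ v → IsListOfSize (size v) (L v)) →
    Σ (V → ℕ) (λ f → (∀ v → f v ∈ L v) × (∀ u v → Adj² u v → f u ≢ f v))
lemma5p19 L L-size =
  colour L L-size , colour∈L L L-size ,
  square-proper (colour L L-size) (colour-injective-on-closedNbhd L L-size)
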